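{- Every oriented graph is an induced subgraph of some homomorphically full oriented graph.
   Context: An oriented graph is a finite simple loopless graph in which each edge is assigned a direction. A homomorphism of oriented graphs maps vertices to vertices so that arcs go to arcs; it is complete if surjective on vertices and on arcs. A homomorphic image of an oriented graph $G$ is an oriented graph $H$ with a complete homomorphism $G\to H$. $G$ is homomorphically full if every homomorphic image of $G$ is isomorphic to a subgraph of $G$. -}

module Defs where

open import Data.Nat using (ℕ)
open import Data.Fin using (Fin)
open import Data.Bool using (Bool; true; false)
open import Data.Product using (Σ; ∃; ∃-syntax; _×_; _,_)
open import Relation.Binary.PropositionalEquality using (_≡_)
open import Relation.Nullary using (¬_)
open import Function.Definitions using (Injective)

record OrientedGraph : Set where
  field
    vertices : ℕ
    arc      : Fin vertices → Fin vertices → Bool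
    loopless : ∀ x → arc x x ≡ false
    oriented : ∀ x y → ¬ (arc x y ≡ true × arc y x ≡ true)

open OrientedGraph public

IsHom : (G H : OrientedGraph) → (Fin (vertices G) → Fin (vertices H)) → Set
IsHom G H f = ∀ x y → arc G x y ≡ true → arc H (f x) (f y) ≡ true

IsCompleteHom : (G H : OrientedGraph) → (Fin (vertices G) → Fin (vertices H)) → Set
IsCompleteHom G H f =
  IsHom G H f
  × (∀ v → ∃[ x ] f x ≡ v)
  × (∀ u v → arc H u v ≡ true →
       ∃[ x ] ∃[ y ] (arc G x y ≡ true × f x ≡ u × f y ≡ v))

HomImage : (G H : OrientedGraph) → Set
HomImage G H = ∃[ f ] IsCompleteHom G H f

IsoToSubgraph : (H G : OrientedGraph) → Set
IsoToSubgraph H G =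
  ∃[ g ] (Injective _≡_ _≡_ g × IsHom H G g)

IsoToInducedSubgraph : (H G : OrientedGraph) → Set
IsoToInducedSubgraph H G =
  ∃[ g ] (Injective _≡_ _≡_ g × (∀ x y → arc H x y ≡ arc G (g x) (g y)))

HomFull : OrientedGraph → Set
HomFull G = ∀ (H : OrientedGraph) → HomImage G H → IsoToSubgraph H G

-- Call an oriented graph linked if any two distinct vertices a, b are joined by an arc
-- (in either direction) or by a directed path a → z → b.  A homomorphism out of a linked
-- graph is injective, since identifying a and b would create a loop or a pair of opposite
-- arcs.  Hence every homomorphic image of a linked graph is a bijective image, and a
-- bijective complete homomorphism has an inverse that is again a homomorphism: linked
-- graphs are homomorphically full.  Every G is an induced subgraph of a linked graph:
-- add a twin ī for each vertex i, with x → ī for x ≠ i, ī → i, and ī → j̄ for i < j.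

module Submission where

open import Defs
open import Data.Bool using (Bool; true; false; not)
open import Data.Empty using (⊥-elim)
open import Data.Fin using (Fin; _≟_; _<?_; splitAt; join; _↑ˡ_)
open import Data.Fin.Properties using (<-irrefl; <-cmp; splitAt-↑ˡ; splitAt-join; join-splitAt; ↑ˡ-injective)
open import Data.Nat using (_+_)
open import Data.Product using (Σ; ∃-syntax; _×_; _,_)
open import Data.Sum using (_⊎_; inj₁; inj₂)
open import Function.Definitions using (Injective)
open import Relation.Binary using (tri<; tri≈; tri>)
open import Relation.Binary.PropositionalEquality
open import Relation.Nullary using (¬_; yes; no; does; contradiction)
open import Relation.Nullary.Decidable using (dec-true; dec-false)

Linked : {A : Set} → (A → A → Bool) → A → A → Set
Linked R a b = R a b ≡ true ⊎ R b a ≡ true ⊎ ∃[ z ] (R a z ≡ true × R z b ≡ true)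

PairwiseLinked : {A : Set} → (A → A → Bool) → Set
PairwiseLinked R = ∀ {a b} → a ≢ b → Linked R a b

pairwiseLinked-pullback : {A B : Set} {R : B → B → Bool} (f : A → B) (s : B → A) →
                          (∀ b → f (s b) ≡ b) → Injective _≡_ _≡_ f →
                          PairwiseLinked R → PairwiseLinked (λ x y → R (f x) (f y))
pairwiseLinked-pullback {R = R} f s fs≗id f-inj linked {a} {b} a≢b
  with linked (λ fa≡fb → a≢b (f-inj fa≡fb))
... | inj₁ ab               = inj₁ ab
... | inj₂ (inj₁ ba)        = inj₂ (inj₁ ba)
... | inj₂ (inj₂ (z , az , zb)) =
  inj₂ (inj₂ (s z , subst (λ w → R (f a) w ≡ true) (sym (fs≗id z)) az
                  , subst (λ w → R w (f b) ≡ true) (sym (fs≗id z)) zb))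

module _ {G H : OrientedGraph} {f : Fin (vertices G) → Fin (vertices H)} (hom : IsHom G H f) where

  hom-no-arc-collapse : ∀ {a b} → f a ≡ f b → arc G a b ≢ true
  hom-no-arc-collapse {a} fa≡fb ab with trans (sym (loopless H (f a)))
                                             (subst (λ w → arc H (f a) w ≡ true) (sym fa≡fb) (hom _ _ ab))
  ... | ()

  hom-no-path-collapse : ∀ {a b z} → f a ≡ f b → ¬ (arc G a z ≡ true × arc G z b ≡ true)
  hom-no-path-collapse {a} {b} {z} fa≡fb (az , zb) =
    oriented H (f a) (f z) (hom a z az , subst (λ w → arc H (f z) w ≡ true) (sym fa≡fb) (hom z b zb))

  pairwiseLinked⇒hom-injective : PairwiseLinked (arc G) → Injective _≡_ _≡_ f
  pairwiseLinked⇒hom-injective linked {a} {b} fa≡fb with a ≟ b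
  ... | yes a≡b = a≡b
  ... | no a≢b with linked a≢b
  ...   | inj₁ ab               = ⊥-elim (hom-no-arc-collapse fa≡fb ab)
  ...   | inj₂ (inj₁ ba)        = ⊥-elim (hom-no-arc-collapse (sym fa≡fb) ba)
  ...   | inj₂ (inj₂ (_ , azb)) = ⊥-elim (hom-no-path-collapse fa≡fb azb)

injective-completeHom⇒isoToSubgraph : ∀ {G H f} → IsCompleteHom G H f → Injective _≡_ _≡_ f →
                                      IsoToSubgraph H G
injective-completeHom⇒isoToSubgraph {G} {H} {f} (_ , onto , arcs-onto) f-inj = g , g-inj , g-hom
  where
  g : Fin (vertices H) → Fin (vertices G)
  g v with onto v
  ... | x , _ = x

  fg≗id : ∀ v → f (g v) ≡ v
  fg≗id v with onto v
  ... | _ , fx≡v = fx≡v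

  g-inj : Injective _≡_ _≡_ g
  g-inj {u} {v} gu≡gv = trans (sym (fg≗id u)) (trans (cong f gu≡gv) (fg≗id v))

  g-hom : IsHom H G g
  g-hom u v uv with arcs-onto u v uv
  ... | x , y , xy , fx≡u , fy≡v =
    subst₂ (λ p q → arc G p q ≡ true)
           (f-inj (trans fx≡u (sym (fg≗id u)))) (f-inj (trans fy≡v (sym (fg≗id v)))) xy

pairwiseLinked⇒homFull : ∀ {G} → PairwiseLinked (arc G) → HomFull G
pairwiseLinked⇒homFull {G} linked H (_ , complete@(hom , _)) =
  injective-completeHom⇒isoToSubgraph {G} {H} complete (pairwiseLinked⇒hom-injective {G} {H} hom linked)

module Extension (G : OrientedGraph) where

  private
    n = vertices G

  Vertex : Set
  Vertex = Fin n ⊎ Fin n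

  arcᴱ : Vertex → Vertex → Bool
  arcᴱ (inj₁ x) (inj₁ y) = arc G x y
  arcᴱ (inj₁ x) (inj₂ j) = not (does (x ≟ j))
  arcᴱ (inj₂ j) (inj₁ y) = does (y ≟ j)
  arcᴱ (inj₂ i) (inj₂ j) = does (i <? j)

  arcᴱ-loopless : ∀ a → arcᴱ a a ≡ false
  arcᴱ-loopless (inj₁ x) = loopless G x
  arcᴱ-loopless (inj₂ i) = dec-false (i <? i) (<-irrefl refl)

  arcᴱ-oriented : ∀ a b → ¬ (arcᴱ a b ≡ true × arcᴱ b a ≡ true)
  arcᴱ-oriented (inj₁ x) (inj₁ y) = oriented G x y
  arcᴱ-oriented (inj₁ x) (inj₂ j) with x ≟ j
  ... | yes _ = λ { (() , _) }
  ... | no _  = λ { (_ , ()) }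
  arcᴱ-oriented (inj₂ j) (inj₁ x) with x ≟ j
  ... | yes _ = λ { (_ , ()) }
  ... | no _  = λ { (() , _) }
  arcᴱ-oriented (inj₂ i) (inj₂ j) (i<ᵇj , j<ᵇi) with <-cmp i j
  ... | tri< _ _ j≮i = contradiction (trans (sym (dec-false (j <? i) j≮i)) j<ᵇi) λ ()
  ... | tri≈ i≮j _ _ = contradiction (trans (sym (dec-false (i <? j) i≮j)) i<ᵇj) λ ()
  ... | tri> i≮j _ _ = contradiction (trans (sym (dec-false (i <? j) i≮j)) i<ᵇj) λ ()

  arcᴱ-pairwiseLinked : PairwiseLinked arcᴱ
  arcᴱ-pairwiseLinked {inj₁ x} {inj₁ y} x≢y =
    inj₂ (inj₂ (inj₂ y , cong not (dec-false (x ≟ y) (λ x≡y → x≢y (cong inj₁ x≡y))) , dec-true (y ≟ y) refl))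
  arcᴱ-pairwiseLinked {inj₁ x} {inj₂ j} _ with x ≟ j
  ... | yes _ = inj₂ (inj₁ refl)
  ... | no _  = inj₁ refl
  arcᴱ-pairwiseLinked {inj₂ j} {inj₁ x} _ with x ≟ j
  ... | yes _ = inj₁ refl
  ... | no _  = inj₂ (inj₁ refl)
  arcᴱ-pairwiseLinked {inj₂ i} {inj₂ j} i≢j with <-cmp i j
  ... | tri< i<j _ _ = inj₁ (dec-true (i <? j) i<j)
  ... | tri≈ _ i≡j _ = ⊥-elim (i≢j (cong inj₂ i≡j))
  ... | tri> _ _ j<i = inj₂ (inj₁ (dec-true (j <? i) j<i))

  extension : OrientedGraph
  extension = record
    { vertices = n + n
    ; arc      = λ a b → arcᴱ (splitAt n a) (splitAt n b)
    ; loopless = λ a → arcᴱ-loopless (splitAt n a)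
    ; oriented = λ a b → arcᴱ-oriented (splitAt n a) (splitAt n b)
    }

  splitAt-injective : Injective _≡_ _≡_ (splitAt n {n})
  splitAt-injective {a} {b} eq =
    trans (sym (join-splitAt n n a)) (trans (cong (join n n) eq) (join-splitAt n n b))

  extension-pairwiseLinked : PairwiseLinked (arc extension)
  extension-pairwiseLinked =
    pairwiseLinked-pullback (splitAt n) (join n n) (splitAt-join n n) splitAt-injective arcᴱ-pairwiseLinked

  extension-induces : IsoToInducedSubgraph G extension
  extension-induces =
    (_↑ˡ n) , (λ {x} {y} → ↑ˡ-injective n x y) ,
    (λ x y → sym (cong₂ arcᴱ (splitAt-↑ˡ n x n) (splitAt-↑ˡ n y n)))

theorem10 : (G : OrientedGraph) → Σ OrientedGraph (λ F → HomFull F × IsoToInducedSubgraph G F)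
theorem10 G = extension , pairwiseLinked⇒homFull {extension} extension-pairwiseLinked , extension-induces
  where open Extension G
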